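{- Let $H$ be a graph with at least one edge, and let $k_0 = \min_{uv \in E(H)} \big(\max\{d_H(u), d_H(v)\} - 1\big)$. Then in any $H$-saturated graph, the set of vertices of degree strictly less than $k_0$ forms a clique.
   Context: Graphs are finite and simple. A graph $G$ is $H$-saturated if $G$ contains no subgraph isomorphic to $H$ but adding any edge joining two nonadjacent vertices of $G$ creates such a subgraph. -}

module Defs where

open import Data.Nat using (ℕ; zero; suc; _+_; _∸_; _⊔_; _≤_; _<_)
open import Data.Fin using (Fin; _≟_)
open import Data.Bool using (Bool; true; false; _∨_; if_then_else_)
open import Data.List using (List; map; allFin)
open import Data.Nat.ListAction using (sum)
open import Data.Product using (Σ; ∃; _×_; _,_)
open import Relation.Binary.PropositionalEquality using (_≡_; _≢_)
open import Relation.Nullary using (¬_; does)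
open import Function.Definitions using (Injective)

record Graph (n : ℕ) : Set where
  field
    adj   : Fin n → Fin n → Bool
    sym   : ∀ u v → adj u v ≡ adj v u
    irrefl : ∀ u → adj u u ≡ false
open Graph public

deg : ∀ {n} → Graph n → Fin n → ℕ
deg G x = sum (map (λ y → if adj G x y then 1 else 0) (allFin _))

-- H is isomorphic to a (not necessarily induced) subgraph of G
_⊆ᴳ_ : ∀ {h n} → Graph h → Graph n → Set
_⊆ᴳ_ {h} {n} H G =
  Σ (Fin h → Fin n) λ f →
    Injective _≡_ _≡_ f × (∀ u v → adj H u v ≡ true → adj G (f u) (f v) ≡ true)

addEdgeAdj : ∀ {n} → Graph n → Fin n → Fin n → Fin n → Fin n → Bool
addEdgeAdj G u v x y =
  adj G x y ∨ ((does (x ≟ u) Data.Bool.∧ does (y ≟ v)) ∨ (does (x ≟ v) Data.Bool.∧ does (y ≟ u)))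
  where import Data.Bool

addEdge : ∀ {n} → (G : Graph n) → (u v : Fin n) → u ≢ v → Graph n
addEdge G u v u≢v = record
  { adj = addEdgeAdj G u v
  ; sym = symProof
  ; irrefl = irreflProof
  }
  where
    open import Data.Bool using (_∧_)
    open import Data.Bool.Properties using (∨-comm)
    open import Relation.Nullary using (yes; no)
    open import Relation.Binary.PropositionalEquality using (refl; cong₂; trans)
    open import Data.Empty using (⊥-elim)
    symProof : ∀ x y → addEdgeAdj G u v x y ≡ addEdgeAdj G u v y x
    symProof x y with x ≟ u | y ≟ v | x ≟ v | y ≟ u
    ... | a | b | c | d rewrite Graph.sym G x y =
      cong₂ _∨_ (refl {x = adj G y x}) (trans (cong₂ _∨_ (lem (does a) (does b)) (lem (does c) (does d))) (∨-comm (does b ∧ does a) (does d ∧ does c)))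
      where
        open import Data.Bool.Properties using (∧-comm)
        lem : ∀ p q → p ∧ q ≡ q ∧ p
        lem p q = ∧-comm p q
    irreflProof : ∀ x → addEdgeAdj G u v x x ≡ false
    irreflProof x rewrite Graph.irrefl G x with x ≟ u | x ≟ v
    ... | yes refl | yes refl = ⊥-elim (u≢v refl)
    ... | yes _ | no _ = refl
    ... | no _ | yes _ = refl
    ... | no _ | no _ = refl

Saturated : ∀ {h n} → Graph h → Graph n → Set
Saturated H G =
  ¬ (H ⊆ᴳ G) ×
  (∀ u v → (u≢v : u ≢ v) → adj G u v ≡ false → H ⊆ᴳ addEdge G u v u≢v)

HasEdge : ∀ {h} → Graph h → Set
HasEdge H = ∃ λ u → ∃ λ v → adj H u v ≡ true

edgeVal : ∀ {h} → Graph h → Fin h → Fin h → ℕ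
edgeVal H u v = (deg H u ⊔ deg H v) ∸ 1

IsK0 : ∀ {h} → Graph h → ℕ → Set
IsK0 H k =
  (∃ λ u → ∃ λ v → adj H u v ≡ true × edgeVal H u v ≡ k) ×
  (∀ u v → adj H u v ≡ true → k ≤ edgeVal H u v)

LowDegClique : ∀ {n} → Graph n → ℕ → Set
LowDegClique G k =
  ∀ x y → x ≢ y → deg G x < k → deg G y < k → adj G x y ≡ true

{-# OPTIONS --safe #-}
module Submission where

-- Let x, y be non-adjacent vertices of degree < k₀ in an H-saturated graph G.
-- A copy of H in G + xy must use the new edge, say as the image of an edge ab
-- of H.  Degrees can only grow along an embedding and adding xy raises them by
-- at most one, so d(a) ≤ d(x) + 1 ≤ k₀ and d(b) ≤ k₀; the value of ab is then
-- below k₀, contradicting its minimality.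

open import Defs hiding (sym)
open import Data.Nat using (ℕ; suc; _⊔_; _≤_; z≤n; s≤s)
open import Data.Nat.Properties
  using (module ≤-Reasoning; ≤-trans; ≤-reflexive; n≤1+n; ⊔-lub; ⊔-mono-≤; ∸-monoˡ-≤; <⇒≱)
open import Data.Nat.ListAction using (sum)
open import Data.Fin using (Fin; zero; suc; _≟_)
open import Data.Fin.Properties using (suc-injective; 0≢1+n)
open import Data.Fin.Subset using (Subset; inside; outside; _∈_; _∉_; _-_; ∣_∣)
open import Data.Fin.Subset.Properties
  using (p─⊥≡p; p─q⊆p; p⊆q⇒∣p∣≤∣q∣; x∈p∧x≢y⇒x∈p-y; x∈p⇒∣p-x∣<∣p∣)
open import Data.Bool using (Bool; true; false; if_then_else_)
import Data.List as List
open import Data.List.Properties using (map-tabulate)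
open import Data.Vec using ([]; _∷_; tabulate; here; there)
open import Data.Vec.Properties using (lookup∘tabulate; []=⇒lookup; lookup⇒[]=)
open import Data.Product using (∃₂; _×_; _,_; proj₁)
open import Data.Sum using (_⊎_; inj₁; inj₂)
open import Data.Empty using (⊥-elim)
open import Function using (_∘_; id)
open import Function.Definitions using (Injective)
open import Relation.Nullary using (¬_; Dec; yes; no; contradiction)
open import Relation.Binary.PropositionalEquality
  using (_≡_; _≢_; refl; sym; trans; cong)

x∉p-x : ∀ {n} (p : Subset n) x → x ∉ p - x
x∉p-x (_ ∷ p) zero    ()
x∉p-x (_ ∷ p) (suc x) (there x∈p-x) = x∉p-x p x x∈p-x

∣p∣≤1+∣p-x∣ : ∀ {n} (p : Subset n) x → ∣ p ∣ ≤ suc ∣ p - x ∣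
∣p∣≤1+∣p-x∣ (inside  ∷ p) zero    = ≤-reflexive (cong (suc ∘ ∣_∣) (sym (p─⊥≡p p)))
∣p∣≤1+∣p-x∣ (outside ∷ p) zero    = ≤-trans (≤-reflexive (cong ∣_∣ (sym (p─⊥≡p p)))) (n≤1+n _)
∣p∣≤1+∣p-x∣ (inside  ∷ p) (suc x) = s≤s (∣p∣≤1+∣p-x∣ p x)
∣p∣≤1+∣p-x∣ (outside ∷ p) (suc x) = ∣p∣≤1+∣p-x∣ p x

injection⇒∣p∣≤∣q∣ : ∀ {m n} (f : Fin m → Fin n) → Injective _≡_ _≡_ f →
  (p : Subset m) (q : Subset n) → (∀ {i} → i ∈ p → f i ∈ q) → ∣ p ∣ ≤ ∣ q ∣
injection⇒∣p∣≤∣q∣ f f-inj []            q f[p]⊆q = z≤n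
injection⇒∣p∣≤∣q∣ f f-inj (outside ∷ p) q f[p]⊆q =
  injection⇒∣p∣≤∣q∣ (f ∘ suc) (suc-injective ∘ f-inj) p q (f[p]⊆q ∘ there)
injection⇒∣p∣≤∣q∣ f f-inj (inside ∷ p) q f[p]⊆q =
  ≤-trans (s≤s (injection⇒∣p∣≤∣q∣ (f ∘ suc) (suc-injective ∘ f-inj) p (q - f zero) f[p]⊆q-f₀))
          (x∈p⇒∣p-x∣<∣p∣ (f[p]⊆q here))
  where
  f[p]⊆q-f₀ : ∀ {i} → i ∈ p → f (suc i) ∈ q - f zero
  f[p]⊆q-f₀ i∈p = x∈p∧x≢y⇒x∈p-y (f[p]⊆q (there i∈p)) (0≢1+n ∘ sym ∘ f-inj)

neighbours : ∀ {n} → Graph n → Fin n → Subset n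
neighbours G x = tabulate (adj G x)

∈-neighbours⁺ : ∀ {n} (G : Graph n) {x y} → adj G x y ≡ true → y ∈ neighbours G x
∈-neighbours⁺ G {x} {y} xy = lookup⇒[]= y _ (trans (lookup∘tabulate (adj G x) y) xy)

∈-neighbours⁻ : ∀ {n} (G : Graph n) {x y} → y ∈ neighbours G x → adj G x y ≡ true
∈-neighbours⁻ G {x} {y} y∈N = trans (sym (lookup∘tabulate (adj G x) y)) ([]=⇒lookup y∈N)

sum-indicator≡∣tabulate∣ : ∀ {n} (f : Fin n → Bool) →
  sum (List.tabulate (λ i → if f i then 1 else 0)) ≡ ∣ tabulate f ∣
sum-indicator≡∣tabulate∣ {0}     f = refl
sum-indicator≡∣tabulate∣ {suc n} f with f zero
... | true  = cong suc (sum-indicator≡∣tabulate∣ (f ∘ suc))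
... | false = sum-indicator≡∣tabulate∣ (f ∘ suc)

deg≡∣neighbours∣ : ∀ {n} (G : Graph n) x → deg G x ≡ ∣ neighbours G x ∣
deg≡∣neighbours∣ {n} G x =
  trans (cong sum (map-tabulate {n = n} id (λ y → if adj G x y then 1 else 0)))
        (sum-indicator≡∣tabulate∣ (adj G x))

deg-mono-⊆ᴳ : ∀ {h n} (H : Graph h) (G : Graph n) (e : H ⊆ᴳ G) a → deg H a ≤ deg G (proj₁ e a)
deg-mono-⊆ᴳ H G (f , f-inj , f-hom) a = begin
  deg H a                ≡⟨ deg≡∣neighbours∣ H a ⟩
  ∣ neighbours H a ∣     ≤⟨ injection⇒∣p∣≤∣q∣ f f-inj _ _ f[N]⊆N ⟩
  ∣ neighbours G (f a) ∣ ≡⟨ deg≡∣neighbours∣ G (f a) ⟨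
  deg G (f a)            ∎
  where
  open ≤-Reasoning
  f[N]⊆N : ∀ {i} → i ∈ neighbours H a → f i ∈ neighbours G (f a)
  f[N]⊆N i∈N = ∈-neighbours⁺ G (f-hom a _ (∈-neighbours⁻ H i∈N))

deg≤1+deg : ∀ {n} (G G′ : Graph n) x y →
  (∀ {z} → z ≢ y → adj G′ x z ≡ true → adj G x z ≡ true) → deg G′ x ≤ suc (deg G x)
deg≤1+deg G G′ x y old-edge = begin
  deg G′ x                     ≡⟨ deg≡∣neighbours∣ G′ x ⟩
  ∣ neighbours G′ x ∣          ≤⟨ ∣p∣≤1+∣p-x∣ (neighbours G′ x) y ⟩
  suc ∣ neighbours G′ x - y ∣  ≤⟨ s≤s (p⊆q⇒∣p∣≤∣q∣ N′-y⊆N) ⟩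
  suc ∣ neighbours G x ∣       ≡⟨ cong suc (deg≡∣neighbours∣ G x) ⟨
  suc (deg G x)                ∎
  where
  open ≤-Reasoning
  N′-y⊆N : ∀ {z} → z ∈ neighbours G′ x - y → z ∈ neighbours G x
  N′-y⊆N z∈N′-y = ∈-neighbours⁺ G (old-edge (λ { refl → x∉p-x _ y z∈N′-y })
                                            (∈-neighbours⁻ G′ (p─q⊆p _ _ z∈N′-y)))

adj-addEdge⁻ : ∀ {n} (G : Graph n) {x y} (x≢y : x ≢ y) {u v} →
  adj (addEdge G x y x≢y) u v ≡ true →
  adj G u v ≡ true ⊎ (u ≡ x × v ≡ y) ⊎ (u ≡ y × v ≡ x)
adj-addEdge⁻ G {x} {y} _ {u} {v} uv with adj G u v | u ≟ x | v ≟ y | u ≟ y | v ≟ x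
... | true  | _         | _         | _         | _         = inj₁ refl
... | false | yes u≡x   | yes v≡y   | _         | _         = inj₂ (inj₁ (u≡x , v≡y))
... | false | _         | _         | yes u≡y   | yes v≡x   = inj₂ (inj₂ (u≡y , v≡x))
adj-addEdge⁻ G _ () | false | no _  | _     | no _  | _
adj-addEdge⁻ G _ () | false | no _  | _     | yes _ | no _
adj-addEdge⁻ G _ () | false | yes _ | no _  | no _  | _
adj-addEdge⁻ G _ () | false | yes _ | no _  | yes _ | no _

deg-addEdge : ∀ {n} (G : Graph n) {x y} (x≢y : x ≢ y) w →
  deg (addEdge G x y x≢y) w ≤ suc (deg G w)
deg-addEdge G {x} {y} x≢y w = deg≤1+deg G G′ w (other-end (w ≟ x)) (old-edge (w ≟ x))
  where
  G′ : Graph _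
  G′ = addEdge G x y x≢y
  other-end : Dec (w ≡ x) → Fin _
  other-end (yes _) = y
  other-end (no _)  = x
  old-edge : (w≟x : Dec (w ≡ x)) →
    ∀ {z} → z ≢ other-end w≟x → adj G′ w z ≡ true → adj G w z ≡ true
  old-edge w≟x z≢end wz with w≟x | adj-addEdge⁻ G x≢y wz
  ... | _       | inj₁ wz-old              = wz-old
  ... | yes _   | inj₂ (inj₁ (_ , z≡y))    = contradiction z≡y z≢end
  ... | yes w≡x | inj₂ (inj₂ (w≡y , _))    = contradiction (trans (sym w≡x) w≡y) x≢y
  ... | no w≢x  | inj₂ (inj₁ (w≡x , _))    = contradiction w≡x w≢x
  ... | no _    | inj₂ (inj₂ (_ , z≡x))    = contradiction z≡x z≢end

CoversEdge : ∀ {h n} → Graph h → (Fin h → Fin n) → Fin n → Fin n → Set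
CoversEdge H f x y = ∃₂ λ a b → adj H a b ≡ true × f a ≡ x × f b ≡ y

⊆ᴳ-addEdge⇒⊆ᴳ : ∀ {h n} (H : Graph h) (G : Graph n) {x y} (x≢y : x ≢ y)
  (e : H ⊆ᴳ addEdge G x y x≢y) → ¬ CoversEdge H (proj₁ e) x y → H ⊆ᴳ G
⊆ᴳ-addEdge⇒⊆ᴳ H G x≢y (f , f-inj , f-hom) ¬covers = f , f-inj , f-hom′
  where
  f-hom′ : ∀ u v → adj H u v ≡ true → adj G (f u) (f v) ≡ true
  f-hom′ u v uv with adj-addEdge⁻ G x≢y (f-hom u v uv)
  ... | inj₁ fufv                 = fufv
  ... | inj₂ (inj₁ (fu≡x , fv≡y)) = contradiction (u , v , uv , fu≡x , fv≡y) ¬covers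
  ... | inj₂ (inj₂ (fu≡y , fv≡x)) =
    contradiction (v , u , trans (Graph.sym H v u) uv , fv≡x , fu≡y) ¬covers

edgeVal≤⊔deg : ∀ {h n} (H : Graph h) (G : Graph n) {x y} (x≢y : x ≢ y)
  (e : H ⊆ᴳ addEdge G x y x≢y) {a b} → proj₁ e a ≡ x → proj₁ e b ≡ y →
  edgeVal H a b ≤ deg G x ⊔ deg G y
-- (suc m ⊔ suc n) ∸ 1 reduces to m ⊔ n.
edgeVal≤⊔deg H G x≢y e fa≡x fb≡y =
  ∸-monoˡ-≤ 1 (⊔-mono-≤ (endpoint-deg fa≡x) (endpoint-deg fb≡y))
  where
  endpoint-deg : ∀ {c w} → proj₁ e c ≡ w → deg H c ≤ suc (deg G w)
  endpoint-deg {c} refl = ≤-trans (deg-mono-⊆ᴳ H (addEdge G _ _ x≢y) e c) (deg-addEdge G x≢y _)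

proposition2p1 : ∀ {h n} (H : Graph h) (G : Graph n) (k₀ : ℕ) →
    HasEdge H → IsK0 H k₀ → Saturated H G → LowDegClique G k₀
proposition2p1 H G k₀ _ (_ , k₀≤edgeVal) (H⊈G , saturated) x y x≢y dx<k₀ dy<k₀
  with adj G x y in xy
... | true  = refl
... | false = ⊥-elim (H⊈G (⊆ᴳ-addEdge⇒⊆ᴳ H G x≢y H⊆G+xy new-edge-unused))
  where
  H⊆G+xy : H ⊆ᴳ addEdge G x y x≢y
  H⊆G+xy = saturated x y x≢y xy
  new-edge-unused : ¬ CoversEdge H (proj₁ H⊆G+xy) x y
  new-edge-unused (a , b , ab , fa≡x , fb≡y) =
    <⇒≱ (⊔-lub dx<k₀ dy<k₀)
        (≤-trans (k₀≤edgeVal a b ab) (edgeVal≤⊔deg H G x≢y H⊆G+xy fa≡x fb≡y))
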